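{- The class of induced subgraphs of the square grid is $(6,1)$-disjointness-expressing.
   Context: All graphs are finite, simple and connected. The square grid is the infinite graph on $\mathbb{Z}^2$ where two points are adjacent iff at Euclidean distance $1$; the class consists of graphs isomorphic to finite (connected) induced subgraphs of it. $N[S]$ denotes the closed neighbourhood of a vertex set $S$. A class $\mathcal{C}$ is $(s,\kappa)$-disjointness-expressing if for some constant $\alpha>0$, for every positive integer $N$ and every $X\subseteq\{1,\dots,N\}$ one can define graphs $L(X)$ and $R(X)$, each containing a labelled set $S$ of special vertices, such that for all $A,B\subseteq\{1,\dots,N\}$: (i) the graph $g(L(A),R(B))$ obtained by identifying each vertex of $S$ in $L(A)$ with the corresponding vertex of $S$ in $R(B)$ is connected and has at most $\alpha N^{1/\kappa}$ vertices; (ii) the subgraph of $g(L(A),R(B))$ induced by $N[S]$ is independent of $A$ and $B$ (for all $A,A',B,B'$ there is an isomorphism between the corresponding induced subgraphs that is the identity on $S$) and has at most $s$ vertices; (iii) $g(L(A),R(B))\in\mathcal{C}$ if and only if $A\cap B=\emptyset$. -}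

module Defs where

open import Data.Nat using (ℕ; zero; suc; _*_; _^_; _≤_)
open import Data.Integer as ℤ using (ℤ; +_) renaming (_-_ to _-ℤ_; _+_ to _+ℤ_; _*_ to _*ℤ_)
open import Data.Fin using (Fin)
open import Data.Fin.Subset using (Subset; _∩_; Empty)
open import Data.Bool using (Bool; true; false; _∨_; T)
open import Data.Maybe using (Maybe; just; nothing)
open import Data.Sum using (_⊎_; inj₁; inj₂)
open import Data.Product using (Σ; Σ-syntax; ∃; ∃-syntax; _×_; _,_; proj₁)
open import Relation.Binary.PropositionalEquality using (_≡_)
open import Relation.Binary.Construct.Closure.ReflexiveTransitive using (Star)
open import Function.Definitions using (Injective)
open import Function.Bundles using (_↔_; _⇔_; Inverse)

GraphClass : Set₁
GraphClass = (V : Set) → (V → V → Bool) → Set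

Connected : (V : Set) → (V → V → Bool) → Set
Connected V E = ∀ u v → Star (λ x y → E x y ≡ true) u v

AtMost : Set → ℕ → Set
AtMost V m = Σ (V → Fin m) (Injective _≡_ _≡_)

GridAdj : ℤ × ℤ → ℤ × ℤ → Set
GridAdj (a , b) (c , d) = (a -ℤ c) *ℤ (a -ℤ c) +ℤ (b -ℤ d) *ℤ (b -ℤ d) ≡ + 1

-- G is isomorphic to a finite connected induced subgraph of the grid:
-- G is connected and there is an injective map f : V → ℤ² such that
-- u ~ v in G iff f u and f v are adjacent in the grid.
GridClass : GraphClass
GridClass V E =
  Connected V E ×
  Σ[ f ∈ (V → ℤ × ℤ) ] (Injective _≡_ _≡_ f × (∀ u v → (E u v ≡ true) ⇔ GridAdj (f u) (f v)))

-- Finite simple graphs with k labelled special vertices.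
-- Vertex set: Fin k ⊎ Fin m, the special vertex with label i being inj₁ i.

record LabGraph (k : ℕ) : Set where
  field
    m      : ℕ
    adj    : Fin k ⊎ Fin m → Fin k ⊎ Fin m → Bool
    sym    : ∀ u v → adj u v ≡ adj v u
    irrefl : ∀ u → adj u u ≡ false

open LabGraph public

-- Vertex set of the glued graph g(L, R): the special vertices (shared),
-- the non-special vertices of L, and the non-special vertices of R.
GlueV : ∀ {k} → LabGraph k → LabGraph k → Set
GlueV {k} L R = Fin k ⊎ (Fin (m L) ⊎ Fin (m R))

projL : ∀ {k} (L R : LabGraph k) → GlueV L R → Maybe (Fin k ⊎ Fin (m L))
projL L R (inj₁ i)        = just (inj₁ i)
projL L R (inj₂ (inj₁ a)) = just (inj₂ a)
projL L R (inj₂ (inj₂ b)) = nothing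

projR : ∀ {k} (L R : LabGraph k) → GlueV L R → Maybe (Fin k ⊎ Fin (m R))
projR L R (inj₁ i)        = just (inj₁ i)
projR L R (inj₂ (inj₁ a)) = nothing
projR L R (inj₂ (inj₂ b)) = just (inj₂ b)

liftAdj : {X : Set} → (X → X → Bool) → Maybe X → Maybe X → Bool
liftAdj a (just x) (just y) = a x y
liftAdj a _ _ = false

GlueE : ∀ {k} (L R : LabGraph k) → GlueV L R → GlueV L R → Bool
GlueE L R u v =
  liftAdj (adj L) (projL L R u) (projL L R v) ∨
  liftAdj (adj R) (projR L R u) (projR L R v)

anyFin : ∀ {k} → (Fin k → Bool) → Bool
anyFin {zero}  p = false
anyFin {suc k} p = p Fin.zero ∨ anyFin (λ i → p (Fin.suc i))

isSpecial : ∀ {k} {A : Set} → Fin k ⊎ A → Bool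
isSpecial (inj₁ _) = true
isSpecial (inj₂ _) = false

inNS : ∀ {k} (L R : LabGraph k) → GlueV L R → Bool
inNS L R v = isSpecial v ∨ anyFin (λ i → GlueE L R v (inj₁ i))

NSV : ∀ {k} (L R : LabGraph k) → Set
NSV L R = Σ (GlueV L R) (λ v → T (inNS L R v))

NSIso : ∀ {k} (L R L' R' : LabGraph k) → Set
NSIso L R L' R' =
  Σ[ φ ∈ (NSV L R ↔ NSV L' R') ]
    ((∀ x y → GlueE L R (proj₁ x) (proj₁ y)
              ≡ GlueE L' R' (proj₁ (Inverse.to φ x)) (proj₁ (Inverse.to φ y))) ×
     (∀ i (p : T (inNS L R (inj₁ i))) → proj₁ (Inverse.to φ (inj₁ i , p)) ≡ inj₁ i))

-- (s, κ)-disjointness-expressing classes.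
-- The bound |V(g)| ≤ α N^{1/κ} (α > 0 real) is expressed equivalently,
-- with c = ⌈α^κ⌉, as |V(g)|^κ ≤ c · N.

DisjointnessExpressing : GraphClass → ℕ → ℕ → Set
DisjointnessExpressing 𝒞 s κ =
  ∃[ c ] (1 ≤ c ×
    (∀ N → 1 ≤ N →
      ∃[ k ] Σ[ L ∈ (Subset N → LabGraph k) ] Σ[ R ∈ (Subset N → LabGraph k) ]
        (∀ A B →
          (Connected (GlueV (L A) (R B)) (GlueE (L A) (R B)) ×
           (∃[ n ] (AtMost (GlueV (L A) (R B)) n × n ^ κ ≤ c * N))) ×
          ((∀ A' B' → NSIso (L A) (R B) (L A') (R B')) ×
           AtMost (NSV (L A) (R B)) s) ×
          (𝒞 (GlueV (L A) (R B)) (GlueE (L A) (R B)) ⇔ Empty (A ∩ B)))))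

-- L(A) and R(B) are subgraphs of the lattice ℕ² induced by vertex positions.
-- L(A) is a ladder in rows 1 and 2 over columns 0 … 2N+2 with, for every i,
-- a pendant vertex in column 2i+3, at height 3 if i ∈ A and at height 0
-- otherwise; the two special vertices sit at (0,3) and (1,3). R(B) is the
-- mirror image in rows 4 … 7 (pendant at height 4 iff i ∈ B), joined to the
-- specials through the vertices (0,4) and (1,4). If A ∩ B = ∅ no non-special
-- vertex of L is lattice-adjacent to one of R, so the glued graph is induced by its
-- positions. If i ∈ A ∩ B, the pendants of i occupy the lattice-adjacent
-- points (2i+3,3) and (2i+3,4) but are not adjacent. Under a grid embedding
-- one square fixes a lattice frame; 2×n ladders are rigid, so the spine in
-- columns 0 and 1 and then both long ladders are mapped to their layout
-- positions, and a pendant whose anchor has its three other neighbours taken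
-- is forced as well. The two pendants of i thus land on adjacent grid points,
-- contradicting that the embedding is induced. N[S] is the block of the six
-- positions with x ≤ 1 and 2 ≤ y ≤ 4, whatever A and B are.

module Submission where

open import Defs hiding (sym)
open import Data.Bool using (Bool; true; false; not; _∧_; _∨_; T; if_then_else_)
open import Data.Bool.Properties using (∨-idem; ∨-identityʳ; ¬-not; not-¬; T-∨; T-≡; T-irrelevant)
open import Data.Empty using (⊥; ⊥-elim)
open import Data.Fin as Fin using (Fin; toℕ; fromℕ<; _↑ˡ_)
open import Data.Fin.Patterns using (0F; 1F; 2F; 3F)
open import Data.Fin.Properties using (all?; _≟_; +↔⊎; *↔×; toℕ-injective; toℕ<n; toℕ-fromℕ<; fromℕ<-toℕ; toℕ-↑ˡ)
open import Data.Fin.Subset using (Subset; _∩_; Empty; _∈_)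
open import Data.Fin.Subset.Properties using (x∈p∩q⁺; x∈p∩q⁻)
open import Data.Integer as ℤ using (ℤ; +_; -[1+_])
open import Data.Integer.Properties as ℤ using (+-injective)
open import Data.Integer.Tactic.RingSolver using (solve-∀)
open import Algebra.Properties.AbelianGroup ℤ.+-0-abelianGroup using (∙-cancelˡ)
open import Data.List as List using (List; []; _∷_)
open import Data.List.Membership.Propositional using () renaming (_∈_ to _∈ˡ_)
open import Data.List.Relation.Unary.Any as Any using (here; there)
open import Data.List.Relation.Unary.Any.Properties using (lookup-index)
open import Data.Nat as ℕ using (ℕ; zero; suc; _+_; _*_; _^_; _≤_; _<_; z≤n; s≤s)
open import Data.Nat.Properties as ℕ using ()
import Data.Nat.Tactic.RingSolver as ℕ-Solver
import Data.Product as Product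
open import Data.Product using (Σ; Σ-syntax; ∃; _×_; _,_; proj₁; proj₂)
open import Data.Product.Properties using (≡-dec)
open import Data.Sum as Sum using (_⊎_; inj₁; inj₂; [_,_])
open import Data.Sum.Function.Propositional using (_⊎-↔_)
open import Data.Vec using (lookup)
open import Data.Vec.Properties using (lookup⇒[]=; []=⇒lookup)
open import Function using (_∘_; id)
open import Function.Bundles using (_⇔_; mk⇔; Equivalence; _↔_; Inverse; _↣_; Injection; mk↔ₛ′)
open import Function.Construct.Identity using (↔-id)
open import Function.Definitions using (Injective)
open import Function.Properties.Inverse using (↔-trans; ↔-sym; ↔⇒↣)
open import Relation.Binary.Construct.Closure.ReflexiveTransitive using (Star; ε; _◅_; _◅◅_; gmap; reverse)
open import Relation.Binary.PropositionalEquality hiding ([_])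
open import Relation.Nullary using (¬_; ¬?; Dec; yes; no; does)
open import Relation.Nullary.Decidable using (toWitness; map′; dec-false; does-⇔; _×-dec_; _⊎-dec_; _→-dec_)

-- Unit steps in ℤ²

Point : Set
Point = ℤ × ℤ

infixl 6 _⊕_
_⊕_ : Point → Point → Point
(a , b) ⊕ (c , d) = (a ℤ.+ c , b ℤ.+ d)

𝟎 : Point
𝟎 = (+ 0 , + 0)

⊕-assoc : ∀ P Q R → P ⊕ Q ⊕ R ≡ P ⊕ (Q ⊕ R)
⊕-assoc (a , b) (c , d) (e , f) = cong₂ _,_ (ℤ.+-assoc a c e) (ℤ.+-assoc b d f)

⊕-comm : ∀ P Q → P ⊕ Q ≡ Q ⊕ P
⊕-comm (a , b) (c , d) = cong₂ _,_ (ℤ.+-comm a c) (ℤ.+-comm b d)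

⊕-identityʳ : ∀ P → P ⊕ 𝟎 ≡ P
⊕-identityʳ (a , b) = cong₂ _,_ (ℤ.+-identityʳ a) (ℤ.+-identityʳ b)

⊕-cancelˡ : ∀ P {Q R} → P ⊕ Q ≡ P ⊕ R → Q ≡ R
⊕-cancelˡ (a , b) eq = cong₂ _,_ (∙-cancelˡ a _ _ (cong proj₁ eq)) (∙-cancelˡ b _ _ (cong proj₂ eq))

_≟ₚ_ : (P Q : Point) → Dec (P ≡ Q)
_≟ₚ_ = ≡-dec ℤ._≟_ ℤ._≟_

Dir : Set
Dir = Fin 4

pattern east  = 0F
pattern north = 1F
pattern west  = 2F
pattern south = 3F

vec : Dir → Point
vec east  = (+ 1 , + 0)
vec north = (+ 0 , + 1)
vec west  = (-[1+ 0 ] , + 0)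
vec south = (+ 0 , -[1+ 0 ])

opp : Dir → Dir
opp east  = west
opp north = south
opp west  = east
opp south = north

Perp : Dir → Dir → Set
Perp u d = ¬ d ≡ u × ¬ d ≡ opp u

Perp? : ∀ u d → Dec (Perp u d)
Perp? u d = ¬? (d ≟ u) ×-dec ¬? (d ≟ opp u)

-- Facts about the four directions are finite checks, decided by evaluation.

opp-involutive : ∀ e → opp (opp e) ≡ e
opp-involutive = toWitness {a? = all? λ e → opp (opp e) ≟ e} _

vec-opp : ∀ e → vec e ⊕ vec (opp e) ≡ 𝟎
vec-opp = toWitness {a? = all? λ e → (vec e ⊕ vec (opp e)) ≟ₚ 𝟎} _

Perp-sym : ∀ {u d} → Perp u d → Perp d u
Perp-sym {u} {d} = toWitness {a? = all? λ u → all? λ d → Perp? u d →-dec Perp? d u} _ u d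

Perp-opp : ∀ {u d} → Perp u d → Perp u (opp d)
Perp-opp {u} {d} = toWitness {a? = all? λ u → all? λ d → Perp? u d →-dec Perp? u (opp d)} _ u d

Perp-cases : ∀ {u d} → Perp u d → ∀ e → e ≡ u ⊎ e ≡ opp u ⊎ e ≡ d ⊎ e ≡ opp d
Perp-cases {u} {d} = toWitness {a? = all? λ u → all? λ d → Perp? u d →-dec
  (all? λ e → (e ≟ u) ⊎-dec (e ≟ opp u) ⊎-dec (e ≟ d) ⊎-dec (e ≟ opp d))} _ u d

opposite-sums : ∀ e e₁ e₂ → vec e ⊕ vec e₁ ≡ vec (opp e) ⊕ vec e₂ → vec e ⊕ vec e₁ ≡ 𝟎
opposite-sums = toWitness {a? = all? λ e → all? λ e₁ → all? λ e₂ →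
  ((vec e ⊕ vec e₁) ≟ₚ (vec (opp e) ⊕ vec e₂)) →-dec ((vec e ⊕ vec e₁) ≟ₚ 𝟎)} _

perpendicular-sums : ∀ {u d} → Perp u d → ∀ e₁ e₂ → vec u ⊕ vec e₁ ≡ vec d ⊕ vec e₂ →
                     vec u ⊕ vec e₁ ≡ 𝟎 ⊎ vec u ⊕ vec e₁ ≡ vec u ⊕ vec d
perpendicular-sums {u} {d} = toWitness {a? = all? λ u → all? λ d → Perp? u d →-dec
  (all? λ e₁ → all? λ e₂ → ((vec u ⊕ vec e₁) ≟ₚ (vec d ⊕ vec e₂)) →-dec
     (((vec u ⊕ vec e₁) ≟ₚ 𝟎) ⊎-dec ((vec u ⊕ vec e₁) ≟ₚ (vec u ⊕ vec d))))} _ u d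

unit-vector : ∀ s t → s ℤ.* s ℤ.+ t ℤ.* t ≡ + 1 → ∃ λ e → (s , t) ≡ vec e
unit-vector (+ 0)           (+ 0)           ()
unit-vector (+ 0)           (+ 1)           _ = north , refl
unit-vector (+ 0)           (+ suc (suc n)) ()
unit-vector (+ 0)           -[1+ 0 ]        _ = south , refl
unit-vector (+ 0)           -[1+ suc n ]    ()
unit-vector (+ 1)           (+ 0)           _ = east , refl
unit-vector (+ 1)           (+ suc n)       ()
unit-vector (+ 1)           -[1+ n ]        ()
unit-vector (+ suc (suc m)) (+ 0)           ()
unit-vector (+ suc (suc m)) (+ suc n)       ()
unit-vector (+ suc (suc m)) -[1+ n ]        ()
unit-vector -[1+ 0 ]        (+ 0)           _ = west , refl
unit-vector -[1+ 0 ]        (+ suc n)       ()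
unit-vector -[1+ 0 ]        -[1+ n ]        ()
unit-vector -[1+ suc m ]    (+ 0)           ()
unit-vector -[1+ suc m ]    (+ suc n)       ()
unit-vector -[1+ suc m ]    -[1+ n ]        ()

GridAdj-sym : ∀ P Q → GridAdj P Q → GridAdj Q P
GridAdj-sym (a , b) (c , d) = trans (distance-sym a b c d)
  where
  distance-sym : ∀ a b c d → (c ℤ.- a) ℤ.* (c ℤ.- a) ℤ.+ (d ℤ.- b) ℤ.* (d ℤ.- b)
                           ≡ (a ℤ.- c) ℤ.* (a ℤ.- c) ℤ.+ (b ℤ.- d) ℤ.* (b ℤ.- d)
  distance-sym = solve-∀

GridAdj⇒step : ∀ P Q → GridAdj P Q → ∃ λ e → Q ≡ P ⊕ vec e
GridAdj⇒step (a , b) (c , d) adj with unit-vector (c ℤ.- a) (d ℤ.- b) (GridAdj-sym (a , b) (c , d) adj)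
... | e , eq = e , trans (cong₂ _,_ (add-difference a c) (add-difference b d)) (cong ((a , b) ⊕_) eq)
  where
  add-difference : ∀ p q → q ≡ p ℤ.+ (q ℤ.- p)
  add-difference = solve-∀

step⇒GridAdj : ∀ P e → GridAdj P (P ⊕ vec e)
step⇒GridAdj (a , b) e = trans (difference-norm a b (proj₁ (vec e)) (proj₂ (vec e))) (unit-norm e)
  where
  difference-norm : ∀ a b s t → (a ℤ.- (a ℤ.+ s)) ℤ.* (a ℤ.- (a ℤ.+ s)) ℤ.+ (b ℤ.- (b ℤ.+ t)) ℤ.* (b ℤ.- (b ℤ.+ t))
                              ≡ s ℤ.* s ℤ.+ t ℤ.* t
  difference-norm = solve-∀
  unit-norm : ∀ e → proj₁ (vec e) ℤ.* proj₁ (vec e) ℤ.+ proj₂ (vec e) ℤ.* proj₂ (vec e) ≡ + 1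
  unit-norm = toWitness {a? = all? λ e → _ ℤ.≟ + 1} _

forth-and-back : ∀ P e → P ⊕ vec e ⊕ vec (opp e) ≡ P
forth-and-back P e = trans (⊕-assoc P (vec e) (vec (opp e))) (trans (cong (P ⊕_) (vec-opp e)) (⊕-identityʳ P))

back-and-forth : ∀ P e → P ⊕ vec (opp e) ⊕ vec e ≡ P
back-and-forth P e = subst (λ e' → P ⊕ vec (opp e) ⊕ vec e' ≡ P) (opp-involutive e) (forth-and-back P (opp e))

two-step-paths : ∀ P {Q} e e' → GridAdj (P ⊕ vec e) Q → GridAdj (P ⊕ vec e') Q →
  ∃ λ e₁ → ∃ λ e₂ → Q ≡ P ⊕ (vec e ⊕ vec e₁) × vec e ⊕ vec e₁ ≡ vec e' ⊕ vec e₂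
two-step-paths P {Q} e e' adj adj' =
  combine (GridAdj⇒step (P ⊕ vec e) Q adj) (GridAdj⇒step (P ⊕ vec e') Q adj')
  where
  via : ∀ e e₁ → Q ≡ P ⊕ vec e ⊕ vec e₁ → Q ≡ P ⊕ (vec e ⊕ vec e₁)
  via e e₁ q = trans q (⊕-assoc P (vec e) (vec e₁))
  combine : (∃ λ e₁ → Q ≡ P ⊕ vec e ⊕ vec e₁) → (∃ λ e₂ → Q ≡ P ⊕ vec e' ⊕ vec e₂) →
            ∃ λ e₁ → ∃ λ e₂ → Q ≡ P ⊕ (vec e ⊕ vec e₁) × vec e ⊕ vec e₁ ≡ vec e' ⊕ vec e₂
  combine (e₁ , q₁) (e₂ , q₂) = e₁ , e₂ , via e e₁ q₁ , ⊕-cancelˡ P (trans (sym (via e e₁ q₁)) (via e' e₂ q₂))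

common-neighbour-opposite : ∀ {P Q} e → GridAdj (P ⊕ vec e) Q → GridAdj (P ⊕ vec (opp e)) Q → Q ≡ P
common-neighbour-opposite {P} {Q} e adj adj' = back (two-step-paths P e (opp e) adj adj')
  where
  back : (∃ λ e₁ → ∃ λ e₂ → Q ≡ P ⊕ (vec e ⊕ vec e₁) × vec e ⊕ vec e₁ ≡ vec (opp e) ⊕ vec e₂) → Q ≡ P
  back (e₁ , e₂ , q , eq) = trans q (trans (cong (P ⊕_) (opposite-sums e e₁ e₂ eq)) (⊕-identityʳ P))

common-neighbour-perpendicular : ∀ {P Q u d} → Perp u d → GridAdj (P ⊕ vec u) Q → GridAdj (P ⊕ vec d) Q →
                                 Q ≡ P ⊎ Q ≡ P ⊕ vec u ⊕ vec d
common-neighbour-perpendicular {P} {Q} {u} {d} u⊥d adj adj' = cases (two-step-paths P u d adj adj')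
  where
  cases : (∃ λ e₁ → ∃ λ e₂ → Q ≡ P ⊕ (vec u ⊕ vec e₁) × vec u ⊕ vec e₁ ≡ vec d ⊕ vec e₂) →
          Q ≡ P ⊎ Q ≡ P ⊕ vec u ⊕ vec d
  cases (e₁ , e₂ , q , eq) = Sum.map (λ cancels → trans q (trans (cong (P ⊕_) cancels) (⊕-identityʳ P)))
                                     (λ diagonal → trans q (trans (cong (P ⊕_) diagonal) (sym (⊕-assoc P (vec u) (vec d)))))
                                     (perpendicular-sums u⊥d e₁ e₂ eq)

-- Rigidity of injective grid embeddings

infixl 7 _⊙_
_⊙_ : ℕ → Point → Point
zero  ⊙ v = 𝟎
suc n ⊙ v = n ⊙ v ⊕ v

⊕-swap : ∀ P Q R → P ⊕ Q ⊕ R ≡ P ⊕ R ⊕ Q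
⊕-swap P Q R = trans (⊕-assoc P Q R) (trans (cong (P ⊕_) (⊕-comm Q R)) (sym (⊕-assoc P R Q)))

module Frame (u d : Dir) (o : Point) where

  at : ℕ × ℕ → Point
  at (x , y) = o ⊕ x ⊙ vec u ⊕ y ⊙ vec d

  at-origin : at (0 , 0) ≡ o
  at-origin = trans (⊕-identityʳ (o ⊕ 𝟎)) (⊕-identityʳ o)

  at-right : ∀ x y → at (suc x , y) ≡ at (x , y) ⊕ vec u
  at-right x y = trans (cong (_⊕ y ⊙ vec d) (sym (⊕-assoc o (x ⊙ vec u) (vec u))))
                       (⊕-swap (o ⊕ x ⊙ vec u) (vec u) (y ⊙ vec d))

  at-up : ∀ x y → at (x , suc y) ≡ at (x , y) ⊕ vec d
  at-up x y = sym (⊕-assoc (o ⊕ x ⊙ vec u) (y ⊙ vec d) (vec d))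

  at-left : ∀ x y → at (x , y) ≡ at (suc x , y) ⊕ vec (opp u)
  at-left x y = sym (trans (cong (_⊕ vec (opp u)) (at-right x y)) (forth-and-back (at (x , y)) u))

  at-down : ∀ x y → at (x , y) ≡ at (x , suc y) ⊕ vec (opp d)
  at-down x y = sym (trans (cong (_⊕ vec (opp d)) (at-up x y)) (forth-and-back (at (x , y)) d))

module Rigidity {V : Set} (f : V → Point) (f-injective : Injective _≡_ _≡_ f) where

  private
    adjacent-at : ∀ {a b P} → f a ≡ P → GridAdj (f a) (f b) → ∃ λ e → f b ≡ P ⊕ vec e
    adjacent-at {a} {b} refl = GridAdj⇒step (f a) (f b)

    occupied : ∀ {a b P} → f a ≡ P → f b ≡ P → a ≡ b
    occupied fa fb = f-injective (trans fa (sym fb))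

    moved : ∀ {a b P} → f a ≡ P → GridAdj (f a) (f b) → GridAdj P (f b)
    moved {b = b} fa = subst (λ P → GridAdj P (f b)) fa

  square-frame : ∀ {a₀₀ a₁₀ a₀₁ a₁₁} →
    GridAdj (f a₀₀) (f a₁₀) → GridAdj (f a₀₀) (f a₀₁) → GridAdj (f a₁₀) (f a₁₁) → GridAdj (f a₀₁) (f a₁₁) →
    ¬ a₀₁ ≡ a₁₀ → ¬ a₁₁ ≡ a₀₀ →
    Σ Dir λ u → Σ Dir λ d → Perp u d × f a₁₀ ≡ f a₀₀ ⊕ vec u × f a₀₁ ≡ f a₀₀ ⊕ vec d ×
                            f a₁₁ ≡ f a₀₀ ⊕ vec u ⊕ vec d
  square-frame {a₀₀} {a₁₀} {a₀₁} {a₁₁} e₁ e₂ e₃ e₄ a₀₁≢a₁₀ a₁₁≢a₀₀ =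
    frame (adjacent-at refl e₁) (adjacent-at refl e₂)
    where
    frame : (∃ λ u → f a₁₀ ≡ f a₀₀ ⊕ vec u) → (∃ λ d → f a₀₁ ≡ f a₀₀ ⊕ vec d) →
            Σ Dir λ u → Σ Dir λ d → Perp u d × f a₁₀ ≡ f a₀₀ ⊕ vec u × f a₀₁ ≡ f a₀₀ ⊕ vec d ×
                                    f a₁₁ ≡ f a₀₀ ⊕ vec u ⊕ vec d
    frame (u , fu) (d , fd) =
      u , d , u⊥d , fu , fd , corner (common-neighbour-perpendicular u⊥d (moved fu e₃) (moved fd e₄))
      where
      u⊥d : Perp u d
      u⊥d = (λ { refl → a₀₁≢a₁₀ (occupied fd fu) })
          , (λ { refl → a₁₁≢a₀₀ (f-injective (common-neighbour-opposite u (moved fu e₃) (moved fd e₄))) })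
      corner : f a₁₁ ≡ f a₀₀ ⊎ f a₁₁ ≡ f a₀₀ ⊕ vec u ⊕ vec d → f a₁₁ ≡ f a₀₀ ⊕ vec u ⊕ vec d
      corner (inj₁ back) = ⊥-elim (a₁₁≢a₀₀ (f-injective back))
      corner (inj₂ ok)   = ok

  square-extend : ∀ {u d} → Perp u d → ∀ {a⁻ a b a' b' P} →
    f a⁻ ≡ P ⊕ vec (opp u) → f a ≡ P → f b ≡ P ⊕ vec d →
    GridAdj (f a) (f a') → GridAdj (f b) (f b') → GridAdj (f a') (f b') →
    ¬ a' ≡ a⁻ → ¬ a' ≡ b → ¬ b' ≡ a →
    f a' ≡ P ⊕ vec u × f b' ≡ P ⊕ vec u ⊕ vec d
  square-extend {u} {d} u⊥d {a⁻} {a} {b} {a'} {b'} {P} fa⁻ fa fb e₁ e₂ e₃ a'≢a⁻ a'≢b b'≢a =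
    extend (adjacent-at fa e₁)
    where
    corner : f b' ≡ P ⊎ f b' ≡ P ⊕ vec u ⊕ vec d → f b' ≡ P ⊕ vec u ⊕ vec d
    corner (inj₁ back) = ⊥-elim (b'≢a (occupied back fa))
    corner (inj₂ ok)   = ok
    by-direction : ∀ e → f a' ≡ P ⊕ vec e → e ≡ u ⊎ e ≡ opp u ⊎ e ≡ d ⊎ e ≡ opp d →
                   f a' ≡ P ⊕ vec u × f b' ≡ P ⊕ vec u ⊕ vec d
    by-direction _ fa' (inj₁ refl) = fa' , corner (common-neighbour-perpendicular u⊥d (moved fa' e₃) (moved fb e₂))
    by-direction _ fa' (inj₂ (inj₁ refl)) = ⊥-elim (a'≢a⁻ (occupied fa' fa⁻))
    by-direction _ fa' (inj₂ (inj₂ (inj₁ refl))) = ⊥-elim (a'≢b (occupied fa' fb))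
    by-direction _ fa' (inj₂ (inj₂ (inj₂ refl))) =
      ⊥-elim (b'≢a (occupied (common-neighbour-opposite d (moved fb e₂) (moved fa' e₃)) fa))
    extend : (∃ λ e → f a' ≡ P ⊕ vec e) → f a' ≡ P ⊕ vec u × f b' ≡ P ⊕ vec u ⊕ vec d
    extend (e , fa') = by-direction e fa' (Perp-cases u⊥d e)

  pendant : ∀ {u d} → Perp u d → ∀ {x x⁻ x⁺ x↓ z P} →
    f x ≡ P → f x⁻ ≡ P ⊕ vec (opp u) → f x⁺ ≡ P ⊕ vec u → f x↓ ≡ P ⊕ vec (opp d) →
    GridAdj (f x) (f z) → ¬ z ≡ x⁻ → ¬ z ≡ x⁺ → ¬ z ≡ x↓ → f z ≡ P ⊕ vec d
  pendant {u} {d} u⊥d {z = z} {P} fx fx⁻ fx⁺ fx↓ e z≢x⁻ z≢x⁺ z≢x↓ = place (adjacent-at fx e)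
    where
    by-direction : ∀ e → f z ≡ P ⊕ vec e → e ≡ u ⊎ e ≡ opp u ⊎ e ≡ d ⊎ e ≡ opp d → f z ≡ P ⊕ vec d
    by-direction _ fz (inj₁ refl)               = ⊥-elim (z≢x⁺ (occupied fz fx⁺))
    by-direction _ fz (inj₂ (inj₁ refl))        = ⊥-elim (z≢x⁻ (occupied fz fx⁻))
    by-direction _ fz (inj₂ (inj₂ (inj₁ refl))) = fz
    by-direction _ fz (inj₂ (inj₂ (inj₂ refl))) = ⊥-elim (z≢x↓ (occupied fz fx↓))
    place : (∃ λ e → f z ≡ P ⊕ vec e) → f z ≡ P ⊕ vec d
    place (e , fz) = by-direction e fz (Perp-cases u⊥d e)

  module Ladder {u d : Dir} (u⊥d : Perp u d) (cell : ℕ → Fin 2 → Point)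
                (cell-next : ∀ k c → cell (suc k) c ≡ cell k c ⊕ vec u)
                (cell-rung : ∀ k → cell k 1F ≡ cell k 0F ⊕ vec d) where

    ladder : ∀ {n} (rung : (k : ℕ) → k < n → Fin 2 → V) (index : V → ℕ) →
      (∀ k p c → index (rung k p c) ≡ k) →
      (∀ k p q c → GridAdj (f (rung k p c)) (f (rung (suc k) q c))) →
      (∀ k p → GridAdj (f (rung k p 0F)) (f (rung k p 1F))) →
      (∀ p c → f (rung 0 p c) ≡ cell 0 c) → (∀ p c → f (rung 1 p c) ≡ cell 1 c) →
      ∀ k p c → f (rung k p c) ≡ cell k c
    ladder {n} rung index index-rung along across placed₀ placed₁ k = proj₁ (placed k)
      where
      Placed : ℕ → Set
      Placed k = ∀ p c → f (rung k p c) ≡ cell k c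

      apart : ∀ {k p c k' p' c'} → ¬ k ≡ k' → ¬ rung k p c ≡ rung k' p' c'
      apart k≢k' eq = k≢k' (trans (sym (index-rung _ _ _)) (trans (cong index eq) (index-rung _ _ _)))

      next : ∀ k → Placed k → Placed (suc k) → Placed (suc (suc k))
      next k placedₖ placedₖ₊₁ p = λ
        { 0F → trans (proj₁ new-rung) (sym (cell-next (suc k) 0F))
        ; 1F → trans (proj₂ new-rung) (trans (cong (_⊕ vec d) (sym (cell-next (suc k) 0F))) (sym (cell-rung (suc (suc k)))))
        }
        where
        q₁ : suc k < n
        q₁ = ℕ.<-trans (ℕ.n<1+n (suc k)) p
        q₀ : k < n
        q₀ = ℕ.<-trans (ℕ.n<1+n k) q₁
        P : Point
        P = cell (suc k) 0F
        behind : cell k 0F ≡ P ⊕ vec (opp u)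
        behind = sym (trans (cong (_⊕ vec (opp u)) (cell-next k 0F)) (forth-and-back (cell k 0F) u))
        new-rung : f (rung (suc (suc k)) p 0F) ≡ P ⊕ vec u × f (rung (suc (suc k)) p 1F) ≡ P ⊕ vec u ⊕ vec d
        new-rung = square-extend u⊥d (trans (placedₖ q₀ 0F) behind) (placedₖ₊₁ q₁ 0F)
                     (trans (placedₖ₊₁ q₁ 1F) (cell-rung (suc k)))
                     (along (suc k) q₁ p 0F) (along (suc k) q₁ p 1F) (across (suc (suc k)) p)
                     (apart (ℕ.m≢1+n+m k ∘ sym)) (apart ℕ.1+n≢n) (apart ℕ.1+n≢n)

      placed : ∀ k → Placed k × Placed (suc k)
      placed zero    = placed₀ , placed₁
      placed (suc k) = proj₂ (placed k) , next k (proj₁ (placed k)) (proj₂ (placed k))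

-- Graphs induced by the lattice ℕ², and their gluing

[,]-injective : ∀ {A B C : Set} {f : A → C} {g : B → C} → Injective _≡_ _≡_ f → Injective _≡_ _≡_ g →
                (∀ a b → ¬ f a ≡ g b) → Injective _≡_ _≡_ [ f , g ]
[,]-injective f-inj g-inj apart {inj₁ a} {inj₁ a'} eq = cong inj₁ (f-inj eq)
[,]-injective f-inj g-inj apart {inj₁ a} {inj₂ b}  eq = ⊥-elim (apart a b eq)
[,]-injective f-inj g-inj apart {inj₂ b} {inj₁ a}  eq = ⊥-elim (apart a b (sym eq))
[,]-injective f-inj g-inj apart {inj₂ b} {inj₂ b'} eq = cong inj₂ (g-inj eq)

infix 4 _∼_
data _∼_ : ℕ × ℕ → ℕ × ℕ → Set where
  right : ∀ {x y} → (x , y) ∼ (suc x , y)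
  left  : ∀ {x y} → (suc x , y) ∼ (x , y)
  up    : ∀ {x y} → (x , y) ∼ (x , suc y)
  down  : ∀ {x y} → (x , suc y) ∼ (x , y)

∼-sym : ∀ {p q} → p ∼ q → q ∼ p
∼-sym right = left
∼-sym left  = right
∼-sym up    = down
∼-sym down  = up

∼-irrefl : ∀ {p} → ¬ p ∼ p
∼-irrefl ()

toℤ² : ℕ × ℕ → Point
toℤ² (x , y) = (+ x , + y)

toℤ²-injective : ∀ {p q} → toℤ² p ≡ toℤ² q → p ≡ q
toℤ²-injective eq = cong₂ _,_ (+-injective (cong proj₁ eq)) (+-injective (cong proj₂ eq))

toℤ²-right : ∀ x y → toℤ² (suc x , y) ≡ toℤ² (x , y) ⊕ vec east
toℤ²-right x y = cong₂ _,_ (cong +_ (ℕ.+-comm 1 x)) (cong +_ (sym (ℕ.+-identityʳ y)))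

toℤ²-up : ∀ x y → toℤ² (x , suc y) ≡ toℤ² (x , y) ⊕ vec north
toℤ²-up x y = cong₂ _,_ (cong +_ (sym (ℕ.+-identityʳ x))) (cong +_ (ℕ.+-comm 1 y))

∼⇒GridAdj : ∀ {p q} → p ∼ q → GridAdj (toℤ² p) (toℤ² q)
∼⇒GridAdj (right {x} {y}) = subst (GridAdj (toℤ² (x , y))) (sym (toℤ²-right x y)) (step⇒GridAdj (toℤ² (x , y)) east)
∼⇒GridAdj (left {x} {y})  = GridAdj-sym (toℤ² (x , y)) (toℤ² (suc x , y)) (∼⇒GridAdj (right {x} {y}))
∼⇒GridAdj (up {x} {y})    = subst (GridAdj (toℤ² (x , y))) (sym (toℤ²-up x y)) (step⇒GridAdj (toℤ² (x , y)) north)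
∼⇒GridAdj (down {x} {y})  = GridAdj-sym (toℤ² (x , y)) (toℤ² (x , suc y)) (∼⇒GridAdj (up {x} {y}))

GridAdj⇒∼ : ∀ p q → GridAdj (toℤ² p) (toℤ² q) → p ∼ q
GridAdj⇒∼ (a , b) (c , d) adj = by-direction (GridAdj⇒step (toℤ² (a , b)) (toℤ² (c , d)) adj)
  where
  one-less : ∀ a c → + c ≡ + a ℤ.+ -[1+ 0 ] → suc c ≡ a
  one-less zero    c ()
  one-less (suc a) c eq = cong suc (+-injective eq)
  one-more : ∀ a c → + c ≡ + a ℤ.+ + 1 → suc a ≡ c
  one-more a c eq = sym (trans (+-injective eq) (ℕ.+-comm a 1))
  same : ∀ a c → + c ≡ + a ℤ.+ + 0 → a ≡ c
  same a c eq = sym (trans (+-injective eq) (ℕ.+-identityʳ a))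
  by-direction : (∃ λ e → toℤ² (c , d) ≡ toℤ² (a , b) ⊕ vec e) → (a , b) ∼ (c , d)
  by-direction (east , eq) =
    subst ((a , b) ∼_) (cong₂ _,_ (one-more a c (cong proj₁ eq)) (same b d (cong proj₂ eq))) right
  by-direction (north , eq) =
    subst ((a , b) ∼_) (cong₂ _,_ (same a c (cong proj₁ eq)) (one-more b d (cong proj₂ eq))) up
  by-direction (west , eq) =
    subst (_∼ (c , d)) (cong₂ _,_ (one-less a c (cong proj₁ eq)) (sym (same b d (cong proj₂ eq)))) left
  by-direction (south , eq) =
    subst (_∼ (c , d)) (cong₂ _,_ (sym (same a c (cong proj₁ eq))) (one-less b d (cong proj₂ eq))) down

_∼?_ : ∀ p q → Dec (p ∼ q)
p ∼? q = map′ (GridAdj⇒∼ p q) ∼⇒GridAdj (_ ℤ.≟ + 1)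

adjacent : ℕ × ℕ → ℕ × ℕ → Bool
adjacent p q = does (p ∼? q)

adjacent⇔∼ : ∀ {p q} → adjacent p q ≡ true ⇔ p ∼ q
adjacent⇔∼ {p} {q} = does⇔ (p ∼? q)
  where
  does⇔ : ∀ {A : Set} (a? : Dec A) → does a? ≡ true ⇔ A
  does⇔ (yes a)  = mk⇔ (λ _ → a) (λ _ → refl)
  does⇔ (no ¬a) = mk⇔ (λ ()) (⊥-elim ∘ ¬a)

adjacent-sym : ∀ p q → adjacent p q ≡ adjacent q p
adjacent-sym p q = does-⇔ (mk⇔ ∼-sym ∼-sym) (p ∼? q) (q ∼? p)

adjacent-irrefl : ∀ p → adjacent p p ≡ false
adjacent-irrefl p = dec-false (p ∼? p) ∼-irrefl

gridGraph : ∀ {k m} {X : Set} → (Fin k → ℕ × ℕ) → (Fin m → X) → (X → ℕ × ℕ) → LabGraph k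
gridGraph {m = m} special decode place = record
  { m      = m
  ; adj    = λ u v → adjacent (position u) (position v)
  ; sym    = λ u v → adjacent-sym (position u) (position v)
  ; irrefl = λ u → adjacent-irrefl (position u)
  }
  where
  position : _ ⊎ _ → ℕ × ℕ
  position = [ special , place ∘ decode ]

GlueV-size : ∀ {k} (L R : LabGraph k) → AtMost (GlueV L R) (k + (m L + m R))
GlueV-size {k} L R = Injection.to count , Injection.injective count
  where
  flatten : Fin (k + (m L + m R)) ↔ GlueV L R
  flatten = ↔-trans +↔⊎ (↔-id _ ⊎-↔ +↔⊎)
  count : GlueV L R ↣ Fin (k + (m L + m R))
  count = ↔⇒↣ (↔-sym flatten)

anyFin-cong : ∀ {k} {p q : Fin k → Bool} → (∀ i → p i ≡ q i) → anyFin p ≡ anyFin q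
anyFin-cong {zero}  eq = refl
anyFin-cong {suc k} eq = cong₂ _∨_ (eq 0F) (anyFin-cong (eq ∘ Fin.suc))

anyFin⇒∃ : ∀ {k} (p : Fin k → Bool) → T (anyFin p) → ∃ λ i → T (p i)
anyFin⇒∃ {suc k} p h with Equivalence.to T-∨ h
... | inj₁ p₀ = 0F , p₀
... | inj₂ pₛ = Product.map Fin.suc id (anyFin⇒∃ (p ∘ Fin.suc) pₛ)

NSV-≡ : ∀ {k} {L R : LabGraph k} {x y : NSV L R} → proj₁ x ≡ proj₁ y → x ≡ y
NSV-≡ {x = u , h} {.u , h'} refl = cong (u ,_) (T-irrelevant h h')

module Glue {k mL mR} {XL XR : Set} (special : Fin k → ℕ × ℕ) (indexL : Fin mL ↔ XL) (indexR : Fin mR ↔ XR) where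

  Vertex : Set
  Vertex = Fin k ⊎ (XL ⊎ XR)

  decode : Fin k ⊎ (Fin mL ⊎ Fin mR) → Vertex
  decode = Sum.map₂ (Sum.map (Inverse.to indexL) (Inverse.to indexR))

  encode : Vertex → Fin k ⊎ (Fin mL ⊎ Fin mR)
  encode = Sum.map₂ (Sum.map (Inverse.from indexL) (Inverse.from indexR))

  decode-encode : ∀ w → decode (encode w) ≡ w
  decode-encode (inj₁ i)        = refl
  decode-encode (inj₂ (inj₁ x)) = cong (inj₂ ∘ inj₁) (Inverse.strictlyInverseˡ indexL x)
  decode-encode (inj₂ (inj₂ y)) = cong (inj₂ ∘ inj₂) (Inverse.strictlyInverseˡ indexR y)

  encode-decode : ∀ u → encode (decode u) ≡ u
  encode-decode (inj₁ i)        = refl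
  encode-decode (inj₂ (inj₁ a)) = cong (inj₂ ∘ inj₁) (Inverse.strictlyInverseʳ indexL a)
  encode-decode (inj₂ (inj₂ b)) = cong (inj₂ ∘ inj₂) (Inverse.strictlyInverseʳ indexR b)

  -- The glued graph has no edge between a non-special vertex of L and one of R.
  cross : Vertex → Vertex → Bool
  cross (inj₂ (inj₁ _)) (inj₂ (inj₂ _)) = true
  cross (inj₂ (inj₂ _)) (inj₂ (inj₁ _)) = true
  cross _               _               = false

  cross-sym : ∀ w w' → cross w w' ≡ cross w' w
  cross-sym (inj₁ _)        (inj₁ _)        = refl
  cross-sym (inj₁ _)        (inj₂ (inj₁ _)) = refl
  cross-sym (inj₁ _)        (inj₂ (inj₂ _)) = refl
  cross-sym (inj₂ (inj₁ _)) (inj₁ _)        = refl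
  cross-sym (inj₂ (inj₁ _)) (inj₂ (inj₁ _)) = refl
  cross-sym (inj₂ (inj₁ _)) (inj₂ (inj₂ _)) = refl
  cross-sym (inj₂ (inj₂ _)) (inj₁ _)        = refl
  cross-sym (inj₂ (inj₂ _)) (inj₂ (inj₁ _)) = refl
  cross-sym (inj₂ (inj₂ _)) (inj₂ (inj₂ _)) = refl

  cross-special : ∀ w i → cross w (inj₁ i) ≡ false
  cross-special (inj₁ _)        _ = refl
  cross-special (inj₂ (inj₁ _)) _ = refl
  cross-special (inj₂ (inj₂ _)) _ = refl

  module Glued (placeL : XL → ℕ × ℕ) (placeR : XR → ℕ × ℕ) where

    L R : LabGraph k
    L = gridGraph special (Inverse.to indexL) placeL
    R = gridGraph special (Inverse.to indexR) placeR

    position : Vertex → ℕ × ℕ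
    position = [ special , [ placeL , placeR ] ]

    GlueE-decode : ∀ u v → GlueE L R u v
                         ≡ not (cross (decode u) (decode v)) ∧ adjacent (position (decode u)) (position (decode v))
    GlueE-decode (inj₁ _)        (inj₁ _)        = ∨-idem _
    GlueE-decode (inj₁ _)        (inj₂ (inj₁ _)) = ∨-identityʳ _
    GlueE-decode (inj₁ _)        (inj₂ (inj₂ _)) = refl
    GlueE-decode (inj₂ (inj₁ _)) (inj₁ _)        = ∨-identityʳ _
    GlueE-decode (inj₂ (inj₁ _)) (inj₂ (inj₁ _)) = ∨-identityʳ _
    GlueE-decode (inj₂ (inj₁ _)) (inj₂ (inj₂ _)) = refl
    GlueE-decode (inj₂ (inj₂ _)) (inj₁ _)        = refl
    GlueE-decode (inj₂ (inj₂ _)) (inj₂ (inj₁ _)) = refl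
    GlueE-decode (inj₂ (inj₂ _)) (inj₂ (inj₂ _)) = refl

    Link : Vertex → Vertex → Set
    Link w w' = cross w w' ≡ false × position w ∼ position w'

    Link-sym : ∀ {w w'} → Link w w' → Link w' w
    Link-sym {w} {w'} (apart , adj) = trans (cross-sym w' w) apart , ∼-sym adj

    edge⇔Link : ∀ u v → GlueE L R u v ≡ true ⇔ Link (decode u) (decode v)
    edge⇔Link u v = subst (λ b → b ≡ true ⇔ Link (decode u) (decode v)) (sym (GlueE-decode u v))
                          (not∧⇔ (cross (decode u) (decode v)) adjacent⇔∼)
      where
      not∧⇔ : ∀ c {a} {A : Set} → a ≡ true ⇔ A → not c ∧ a ≡ true ⇔ (c ≡ false × A)
      not∧⇔ false a⇔A = mk⇔ (λ e → refl , Equivalence.to a⇔A e) (Equivalence.from a⇔A ∘ proj₂)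
      not∧⇔ true  _   = mk⇔ (λ ()) (λ { (() , _) })

    encoded-edge⇔Link : ∀ w w' → GlueE L R (encode w) (encode w') ≡ true ⇔ Link w w'
    encoded-edge⇔Link w w' = subst₂ (λ x y → GlueE L R (encode w) (encode w') ≡ true ⇔ Link x y)
                                    (decode-encode w) (decode-encode w') (edge⇔Link (encode w) (encode w'))

    connected : (root : Vertex) → (∀ w → Star Link w root) → Connected (GlueV L R) (GlueE L R)
    connected root path u v = subst₂ (Star _) (encode-decode u) (encode-decode v)
      (gmap encode (λ {w} {w'} → Equivalence.from (encoded-edge⇔Link w w'))
                   (path (decode u) ◅◅ reverse Link-sym (path (decode v))))

    decode-injective : Injective _≡_ _≡_ decode
    decode-injective {u} {v} eq = trans (sym (encode-decode u)) (trans (cong encode eq) (encode-decode v))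

    encode-injective : Injective _≡_ _≡_ encode
    encode-injective {w} {w'} eq = trans (sym (decode-encode w)) (trans (cong decode eq) (decode-encode w'))

    gridClass : Connected (GlueV L R) (GlueE L R) → Injective _≡_ _≡_ position →
                (∀ w w' → cross w w' ≡ true → ¬ position w ∼ position w') → GridClass (GlueV L R) (GlueE L R)
    gridClass conn position-injective no-cross-adjacency =
      conn , toℤ² ∘ position ∘ decode , decode-injective ∘ position-injective ∘ toℤ²-injective , realises
      where
      realises : ∀ u v → GlueE L R u v ≡ true ⇔ GridAdj (toℤ² (position (decode u))) (toℤ² (position (decode v)))
      realises u v = mk⇔ (∼⇒GridAdj ∘ proj₂ ∘ Equivalence.to (edge⇔Link u v)) λ adj →
        let adj∼ = GridAdj⇒∼ (position (decode u)) (position (decode v)) adj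
        in Equivalence.from (edge⇔Link u v) (¬-not (λ c → no-cross-adjacency _ _ c adj∼) , adj∼)

    grid-embedding : GridClass (GlueV L R) (GlueE L R) →
      Σ[ g ∈ (Vertex → Point) ] (Injective _≡_ _≡_ g ×
        (∀ w w' → Link w w' → GridAdj (g w) (g w')) × (∀ w w' → cross w w' ≡ true → ¬ GridAdj (g w) (g w')))
    grid-embedding (_ , f , f-injective , realises) =
      f ∘ encode , encode-injective ∘ f-injective ,
      (λ w w' → Equivalence.to (realises (encode w) (encode w')) ∘ Equivalence.from (encoded-edge⇔Link w w')) ,
      λ w w' c adj → not-¬ c (proj₁ (Equivalence.to (encoded-edge⇔Link w w')
                                       (Equivalence.from (realises (encode w) (encode w')) adj)))

    toward-special : ∀ u i → GlueE L R u (inj₁ i) ≡ adjacent (position (decode u)) (special i)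
    toward-special u i = trans (GlueE-decode u (inj₁ i))
      (cong (λ c → not c ∧ adjacent (position (decode u)) (special i)) (cross-special (decode u) i))

    N[S]-neighbour : ∀ a → T (inNS L R (inj₂ a)) → ∃ λ i → position (decode (inj₂ a)) ∼ special i
    N[S]-neighbour a h = Product.map₂ (λ {i} t → Equivalence.to adjacent⇔∼
      (trans (sym (toward-special (inj₂ a) i)) (Equivalence.to T-≡ t))) (anyFin⇒∃ _ h)

    N[S]-size : Injective _≡_ _≡_ position → (xs : List (ℕ × ℕ)) →
      (∀ i → special i ∈ˡ xs) → (∀ w i → position w ∼ special i → position w ∈ˡ xs) →
      AtMost (NSV L R) (List.length xs)
    N[S]-size position-injective xs specials∈ neighbours∈ = Any.index ∘ listed , λ {x} {y} eq →
      NSV-≡ (decode-injective (position-injective (trans (lookup-index (listed x))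
                                                  (trans (cong (List.lookup xs) eq) (sym (lookup-index (listed y)))))))
      where
      listed : (x : NSV L R) → position (decode (proj₁ x)) ∈ˡ xs
      listed (inj₁ i , _) = specials∈ i
      listed (inj₂ a , h) = neighbours∈ (decode (inj₂ a)) _ (proj₂ (N[S]-neighbour a h))

  Away : ℕ × ℕ → Set
  Away p = ∀ i → ¬ p ∼ special i

  N[S]-iso : ∀ {placeL placeL' placeR placeR'} →
    (∀ x → placeL x ≡ placeL' x ⊎ Away (placeL x) × Away (placeL' x)) →
    (∀ y → placeR y ≡ placeR' y ⊎ Away (placeR y) × Away (placeR' y)) →
    NSIso (Glued.L placeL placeR) (Glued.R placeL placeR) (Glued.L placeL' placeR') (Glued.R placeL' placeR')
  N[S]-iso {placeL} {placeL'} {placeR} {placeR'} stableL stableR = φ , preserves , λ _ _ → refl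
    where
    module G  = Glued placeL placeR
    module G' = Glued placeL' placeR'

    stable : ∀ w → G.position w ≡ G'.position w ⊎ Away (G.position w) × Away (G'.position w)
    stable (inj₁ _)        = inj₁ refl
    stable (inj₂ (inj₁ x)) = stableL x
    stable (inj₂ (inj₂ y)) = stableR y

    toward-special-same : ∀ u i → GlueE G.L G.R u (inj₁ i) ≡ GlueE G'.L G'.R u (inj₁ i)
    toward-special-same u i =
      trans (G.toward-special u i) (trans (same (stable (decode u))) (sym (G'.toward-special u i)))
      where
      same : ∀ {p p'} → p ≡ p' ⊎ Away p × Away p' → adjacent p (special i) ≡ adjacent p' (special i)
      same (inj₁ refl)           = refl
      same (inj₂ (away , away')) = trans (dec-false (_ ∼? _) (away i)) (sym (dec-false (_ ∼? _) (away' i)))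

    inNS-same : ∀ u → inNS G.L G.R u ≡ inNS G'.L G'.R u
    inNS-same u = cong (isSpecial u ∨_) (anyFin-cong (toward-special-same u))

    same-position : ∀ u → T (inNS G.L G.R u) → G.position (decode u) ≡ G'.position (decode u)
    same-position (inj₁ _) _ = refl
    same-position (inj₂ a) h with stable (decode (inj₂ a))
    ... | inj₁ eq         = eq
    ... | inj₂ (away , _) = ⊥-elim (away _ (proj₂ (G.N[S]-neighbour a h)))

    to : NSV G.L G.R → NSV G'.L G'.R
    to (u , h) = u , subst T (inNS-same u) h

    from : NSV G'.L G'.R → NSV G.L G.R
    from (u , h) = u , subst T (sym (inNS-same u)) h

    φ : NSV G.L G.R ↔ NSV G'.L G'.R
    φ = mk↔ₛ′ to from (λ _ → NSV-≡ refl) (λ _ → NSV-≡ refl)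

    preserves : ∀ x y → GlueE G.L G.R (proj₁ x) (proj₁ y) ≡ GlueE G'.L G'.R (proj₁ (to x)) (proj₁ (to y))
    preserves (u , h) (v , h') = trans (G.GlueE-decode u v) (trans
      (cong₂ (λ p q → not (cross (decode u) (decode v)) ∧ adjacent p q) (same-position u h) (same-position v h'))
      (sym (G'.GlueE-decode u v)))

-- The gadget

module Construction (N : ℕ) where

  width : ℕ
  width = 3 + (N + N)

  bumpColumn : Fin N → ℕ
  bumpColumn i = 3 + (toℕ i + toℕ i)

  bumpColumn-injective : Injective _≡_ _≡_ bumpColumn
  bumpColumn-injective {i} {j} eq = toℕ-injective (double-injective (toℕ i) (toℕ j) (ℕ.+-cancelˡ-≡ 3 _ _ eq))
    where
    double-injective : ∀ a b → a + a ≡ b + b → a ≡ b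
    double-injective zero    zero    _  = refl
    double-injective zero    (suc b) ()
    double-injective (suc a) zero    ()
    double-injective (suc a) (suc b) eq =
      cong suc (double-injective a b
        (ℕ.suc-injective (trans (sym (ℕ.+-suc a a)) (trans (ℕ.suc-injective eq) (ℕ.+-suc b b)))))

  bumpColumn+1<width : ∀ i → suc (bumpColumn i) < width
  bumpColumn+1<width i = s≤s (s≤s (s≤s (subst (_≤ N + N) (cong suc (ℕ.+-suc (toℕ i) (toℕ i)))
                                                  (ℕ.+-mono-≤ (toℕ<n i) (toℕ<n i)))))

  bumpColumn<width : ∀ i → bumpColumn i < width
  bumpColumn<width i = ℕ.<-trans (ℕ.n<1+n (bumpColumn i)) (bumpColumn+1<width i)

  Side : Set
  Side = (Fin width × Fin 2) ⊎ Fin N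

  pattern rung x r = inj₁ (x , r)
  pattern bump i   = inj₂ i

  side↔ : Fin (width * 2 + N) ↔ Side
  side↔ = ↔-trans +↔⊎ (*↔× ⊎-↔ ↔-id _)

  linked↔ : Fin (2 + (width * 2 + N)) ↔ (Fin 2 ⊎ Side)
  linked↔ = ↔-trans (+↔⊎ {2}) (↔-id (Fin 2) ⊎-↔ side↔)

  special : Fin 2 → ℕ × ℕ
  special c = (toℕ c , 3)

  placeL : Subset N → Side → ℕ × ℕ
  placeL A (rung x r) = (toℕ x , 1 + toℕ r)
  placeL A (bump i)   = (bumpColumn i , (if lookup A i then 3 else 0))

  placeR : Subset N → Fin 2 ⊎ Side → ℕ × ℕ
  placeR B (inj₁ c)          = (toℕ c , 4)
  placeR B (inj₂ (rung x r)) = (toℕ x , 5 + toℕ r)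
  placeR B (inj₂ (bump i))   = (bumpColumn i , (if lookup B i then 4 else 7))

  open Glue special side↔ linked↔ public

  leftGraph rightGraph : Subset N → LabGraph 2
  leftGraph  A = gridGraph special (Inverse.to side↔) (placeL A)
  rightGraph B = gridGraph special (Inverse.to linked↔) (placeR B)

  pattern lRung x r = inj₂ (inj₁ (inj₁ (x , r)))
  pattern lBump i   = inj₂ (inj₁ (inj₂ i))
  pattern link c    = inj₂ (inj₂ (inj₁ c))
  pattern rRung x r = inj₂ (inj₂ (inj₂ (inj₁ (x , r))))
  pattern rBump i   = inj₂ (inj₂ (inj₂ (inj₂ i)))

  ∼-row≤ : ∀ {p q} → p ∼ q → proj₂ q ≤ suc (proj₂ p)
  ∼-row≤ right = ℕ.n≤1+n _
  ∼-row≤ left  = ℕ.n≤1+n _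
  ∼-row≤ up    = ℕ.≤-refl
  ∼-row≤ down  = ℕ.m≤n⇒m≤1+n (ℕ.n≤1+n _)

  bump-away : ∀ i y → Away (bumpColumn i , y)
  bump-away i y 0F ()
  bump-away i y 1F ()

  placeL-stable : ∀ A A' x → placeL A x ≡ placeL A' x ⊎ Away (placeL A x) × Away (placeL A' x)
  placeL-stable A A' (rung _ _) = inj₁ refl
  placeL-stable A A' (bump i)   = inj₂ (bump-away i _ , bump-away i _)

  placeR-stable : ∀ B B' y → placeR B y ≡ placeR B' y ⊎ Away (placeR B y) × Away (placeR B' y)
  placeR-stable B B' (inj₁ _)          = inj₁ refl
  placeR-stable B B' (inj₂ (rung _ _)) = inj₁ refl
  placeR-stable B B' (inj₂ (bump i))   = inj₂ (bump-away i _ , bump-away i _)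

  near-specials : List (ℕ × ℕ)
  near-specials = (0 , 2) ∷ (1 , 2) ∷ (0 , 3) ∷ (1 , 3) ∷ (0 , 4) ∷ (1 , 4) ∷ []

  special∈near : ∀ c → special c ∈ˡ near-specials
  special∈near 0F = there (there (here refl))
  special∈near 1F = there (there (there (here refl)))

  -- (2 , 3) is the one lattice neighbour of the specials that no vertex occupies.
  neighbour∈near : ∀ {p} c → p ∼ special c → ¬ p ≡ (2 , 3) → p ∈ˡ near-specials
  neighbour∈near 0F left  _ = there (there (there (here refl)))
  neighbour∈near 0F up    _ = here refl
  neighbour∈near 0F down  _ = there (there (there (there (here refl))))
  neighbour∈near 1F right _ = there (there (here refl))
  neighbour∈near 1F left  p≢ = ⊥-elim (p≢ refl)
  neighbour∈near 1F up    _ = there (here refl)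
  neighbour∈near 1F down  _ = there (there (there (there (there (here refl)))))

  module Layout (A B : Subset N) where

    open Glued (placeL A) (placeR B) public

    placeL-row≤3 : ∀ x → proj₂ (placeL A x) ≤ 3
    placeL-row≤3 (rung _ 0F) = s≤s z≤n
    placeL-row≤3 (rung _ 1F) = s≤s (s≤s z≤n)
    placeL-row≤3 (bump i) with lookup A i
    ... | true  = ℕ.≤-refl
    ... | false = z≤n

    placeR-row≥4 : ∀ y → 4 ≤ proj₂ (placeR B y)
    placeR-row≥4 (inj₁ _)          = ℕ.≤-refl
    placeR-row≥4 (inj₂ (rung _ r)) = ℕ.m≤m+n 4 _
    placeR-row≥4 (inj₂ (bump i)) with lookup B i
    ... | true  = ℕ.≤-refl
    ... | false = ℕ.m≤m+n 4 3

    placeL≢placeR : ∀ x y → ¬ placeL A x ≡ placeR B y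
    placeL≢placeR x y eq = ℕ.<-irrefl refl (ℕ.≤-trans (placeR-row≥4 y) (subst (_≤ 3) (cong proj₂ eq) (placeL-row≤3 x)))

    placeL-injective : Injective _≡_ _≡_ (placeL A)
    placeL-injective {rung x r} {rung x' r'} eq =
      cong₂ (λ x r → rung x r) (toℕ-injective (cong proj₁ eq)) (toℕ-injective (ℕ.suc-injective (cong proj₂ eq)))
    placeL-injective {rung _ r} {bump i} eq with lookup A i | r
    placeL-injective {rung _ r} {bump i} () | true  | 0F
    placeL-injective {rung _ r} {bump i} () | true  | 1F
    placeL-injective {rung _ r} {bump i} () | false | 0F
    placeL-injective {rung _ r} {bump i} () | false | 1F
    placeL-injective {bump i} {rung x r} eq = sym (placeL-injective (sym eq))
    placeL-injective {bump i} {bump j} eq = cong bump (bumpColumn-injective (cong proj₁ eq))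

    placeR-injective : Injective _≡_ _≡_ (placeR B)
    placeR-injective {inj₁ c} {inj₁ c'} eq = cong inj₁ (toℕ-injective (cong proj₁ eq))
    placeR-injective {inj₁ c} {inj₂ (rung x r)} ()
    placeR-injective {inj₁ 0F} {inj₂ (bump i)} ()
    placeR-injective {inj₁ 1F} {inj₂ (bump i)} ()
    placeR-injective {inj₂ (rung x r)} {inj₂ (rung x' r')} eq =
      cong₂ (λ x r → inj₂ (rung x r)) (toℕ-injective (cong proj₁ eq)) (toℕ-injective (ℕ.+-cancelˡ-≡ 5 _ _ (cong proj₂ eq)))
    placeR-injective {inj₂ (rung _ r)} {inj₂ (bump i)} eq with lookup B i | r
    placeR-injective {inj₂ (rung _ r)} {inj₂ (bump i)} () | true  | _
    placeR-injective {inj₂ (rung _ r)} {inj₂ (bump i)} () | false | 0F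
    placeR-injective {inj₂ (rung _ r)} {inj₂ (bump i)} () | false | 1F
    placeR-injective {inj₂ (bump i)} {inj₂ (bump j)} eq = cong (inj₂ ∘ bump) (bumpColumn-injective (cong proj₁ eq))
    placeR-injective {inj₂ (rung _ _)} {inj₁ _} ()
    placeR-injective {inj₂ (bump _)} {inj₁ 0F} ()
    placeR-injective {inj₂ (bump _)} {inj₁ 1F} ()
    placeR-injective {inj₂ (bump _)} {inj₂ (rung _ _)} eq = sym (placeR-injective (sym eq))

    special≢placeL : ∀ c x → ¬ special c ≡ placeL A x
    special≢placeL c (rung _ 0F) ()
    special≢placeL c (rung _ 1F) ()
    special≢placeL c (bump i) eq with lookup A i
    special≢placeL 0F (bump i) () | true
    special≢placeL 1F (bump i) () | true
    special≢placeL c  (bump i) () | false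

    position-injective : Injective _≡_ _≡_ position
    position-injective = [,]-injective (toℕ-injective ∘ cong proj₁)
      ([,]-injective placeL-injective placeR-injective placeL≢placeR)
      λ { c (inj₁ x) → special≢placeL c x
        ; c (inj₂ y) eq → ℕ.<-irrefl refl (subst (4 ≤_) (sym (cong proj₂ eq)) (placeR-row≥4 y)) }

    row≤2⇒¬∼placeR : ∀ {p} → proj₂ p ≤ 2 → ∀ y → ¬ p ∼ placeR B y
    row≤2⇒¬∼placeR p≤2 y adj = ℕ.<-irrefl refl (ℕ.≤-trans (placeR-row≥4 y) (ℕ.≤-trans (∼-row≤ adj) (s≤s p≤2)))

    ∼-vertical : ∀ {a b y} → (a , y) ∼ (b , suc y) → a ≡ b
    ∼-vertical up = refl

    cross-adjacent⇒∈∩ : ∀ x y → placeL A x ∼ placeR B y → ∃ λ i → i ∈ A ∩ B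
    cross-adjacent⇒∈∩ (rung _ 0F) y adj = ⊥-elim (row≤2⇒¬∼placeR (s≤s z≤n) y adj)
    cross-adjacent⇒∈∩ (rung _ 1F) y adj = ⊥-elim (row≤2⇒¬∼placeR (s≤s (s≤s z≤n)) y adj)
    cross-adjacent⇒∈∩ (bump i) y adj with lookup A i in i∈A
    ... | false = ⊥-elim (row≤2⇒¬∼placeR z≤n y adj)
    cross-adjacent⇒∈∩ (bump i) (inj₁ 0F)          () | true
    cross-adjacent⇒∈∩ (bump i) (inj₁ 1F)          () | true
    cross-adjacent⇒∈∩ (bump i) (inj₂ (rung _ _)) () | true
    cross-adjacent⇒∈∩ (bump i) (inj₂ (bump j)) adj | true with lookup B j in j∈B
    cross-adjacent⇒∈∩ (bump i) (inj₂ (bump j)) () | true | false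
    cross-adjacent⇒∈∩ (bump i) (inj₂ (bump j)) adj | true | true =
      i , x∈p∩q⁺ (lookup⇒[]= i A i∈A ,
                  lookup⇒[]= i B (subst (λ k → lookup B k ≡ true) (sym (bumpColumn-injective (∼-vertical adj))) j∈B))

    no-cross-adjacency : Empty (A ∩ B) → ∀ w w' → cross w w' ≡ true → ¬ position w ∼ position w'
    no-cross-adjacency disjoint (inj₂ (inj₁ x)) (inj₂ (inj₂ y)) _ adj = disjoint (cross-adjacent⇒∈∩ x y adj)
    no-cross-adjacency disjoint (inj₂ (inj₂ y)) (inj₂ (inj₁ x)) _ adj = disjoint (cross-adjacent⇒∈∩ x y (∼-sym adj))
    no-cross-adjacency disjoint (inj₁ _)        _               ()
    no-cross-adjacency disjoint (inj₂ (inj₁ _)) (inj₁ _)        ()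
    no-cross-adjacency disjoint (inj₂ (inj₁ _)) (inj₂ (inj₁ _)) ()
    no-cross-adjacency disjoint (inj₂ (inj₂ _)) (inj₁ _)        ()
    no-cross-adjacency disjoint (inj₂ (inj₂ _)) (inj₂ (inj₂ _)) ()

    link-at : ∀ w w' {p q} → cross w w' ≡ false → position w ≡ p → position w' ≡ q → p ∼ q → Link w w'
    link-at _ _ apart refl refl adj = apart , adj

    walk-row : (v : Fin width → Vertex) (y : ℕ) → (∀ x → position (v x) ≡ (toℕ x , y)) →
               (∀ x x' → cross (v x) (v x') ≡ false) → ∀ x → Star Link (v x) (v 0F)
    walk-row v y on-row apart x =
      subst (λ z → Star Link (v z) (v 0F)) (fromℕ<-toℕ x (toℕ<n x)) (walk (toℕ x) (toℕ<n x))
      where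
      at : ∀ {n} (p : n < width) → position (v (fromℕ< p)) ≡ (n , y)
      at p = trans (on-row _) (cong (_, y) (toℕ-fromℕ< p))
      walk : ∀ n (p : n < width) → Star Link (v (fromℕ< p)) (v 0F)
      walk zero    p = ε
      walk (suc n) p = link-at (v (fromℕ< p)) (v (fromℕ< q)) (apart _ _) (at p) (at q) left ◅ walk n q
        where q = ℕ.<-trans (ℕ.n<1+n n) p

    lBump-at : ∀ {i b} → lookup A i ≡ b → position (lBump i) ≡ (bumpColumn i , (if b then 3 else 0))
    lBump-at refl = refl

    rBump-at : ∀ {i b} → lookup B i ≡ b → position (rBump i) ≡ (bumpColumn i , (if b then 4 else 7))
    rBump-at refl = refl

    lBump-anchor : ∀ i → Σ (Fin 2) λ r → Link (lBump i) (lRung (fromℕ< (bumpColumn<width i)) r)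
    lBump-anchor i = anchor (lookup A i) refl
      where
      x≡ : toℕ (fromℕ< (bumpColumn<width i)) ≡ bumpColumn i
      x≡ = toℕ-fromℕ< (bumpColumn<width i)
      anchor : ∀ b → lookup A i ≡ b → Σ (Fin 2) λ r → Link (lBump i) (lRung (fromℕ< (bumpColumn<width i)) r)
      anchor true  i∈A = 1F , link-at (lBump i) (lRung _ 1F) refl (lBump-at i∈A) (cong (_, 2) x≡) down
      anchor false i∉A = 0F , link-at (lBump i) (lRung _ 0F) refl (lBump-at i∉A) (cong (_, 1) x≡) up

    rBump-anchor : ∀ i → Σ (Fin 2) λ r → Link (rBump i) (rRung (fromℕ< (bumpColumn<width i)) r)
    rBump-anchor i = anchor (lookup B i) refl
      where
      x≡ : toℕ (fromℕ< (bumpColumn<width i)) ≡ bumpColumn i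
      x≡ = toℕ-fromℕ< (bumpColumn<width i)
      anchor : ∀ b → lookup B i ≡ b → Σ (Fin 2) λ r → Link (rBump i) (rRung (fromℕ< (bumpColumn<width i)) r)
      anchor true  i∈B = 0F , link-at (rBump i) (rRung _ 0F) refl (rBump-at i∈B) (cong (_, 5) x≡) up
      anchor false i∉B = 1F , link-at (rBump i) (rRung _ 1F) refl (rBump-at i∉B) (cong (_, 6) x≡) down

    from-lRung : ∀ x r → Star Link (lRung x r) (inj₁ 0F)
    from-lRung x r = walk-row (λ x → lRung x r) (1 + toℕ r) (λ _ → refl) (λ _ _ → refl) x ◅◅ climb r
      where
      climb : ∀ r → Star Link (lRung 0F r) (inj₁ 0F)
      climb 0F = (refl , up) ◅ climb 1F
      climb 1F = (refl , up) ◅ ε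

    from-link : ∀ c → Star Link (link c) (inj₁ 0F)
    from-link 0F = (refl , down) ◅ ε
    from-link 1F = (refl , left) ◅ from-link 0F

    from-rRung : ∀ x r → Star Link (rRung x r) (inj₁ 0F)
    from-rRung x r = walk-row (λ x → rRung x r) (5 + toℕ r) (λ _ → refl) (λ _ _ → refl) x ◅◅ descend r
      where
      descend : ∀ r → Star Link (rRung 0F r) (inj₁ 0F)
      descend 0F = (refl , down) ◅ from-link 0F
      descend 1F = (refl , down) ◅ descend 0F

    reach : ∀ w → Star Link w (inj₁ 0F)
    reach (inj₁ 0F)   = ε
    reach (inj₁ 1F)   = (refl , left) ◅ ε
    reach (lRung x r) = from-lRung x r
    reach (lBump i)   = proj₂ (lBump-anchor i) ◅ from-lRung _ (proj₁ (lBump-anchor i))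
    reach (link c)    = from-link c
    reach (rRung x r) = from-rRung x r
    reach (rBump i)   = proj₂ (rBump-anchor i) ◅ from-rRung _ (proj₁ (rBump-anchor i))

    nothing-at-2,3 : ∀ w → ¬ position w ≡ (2 , 3)
    nothing-at-2,3 (inj₁ 0F)    ()
    nothing-at-2,3 (inj₁ 1F)    ()
    nothing-at-2,3 (lRung _ 0F) ()
    nothing-at-2,3 (lRung _ 1F) ()
    nothing-at-2,3 (lBump _)    ()
    nothing-at-2,3 (link _)     ()
    nothing-at-2,3 (rRung _ _)  ()
    nothing-at-2,3 (rBump _)    ()

    N[S]-has-six : AtMost (NSV L R) 6
    N[S]-has-six = N[S]-size position-injective near-specials special∈near
      λ w c adj → neighbour∈near c adj (nothing-at-2,3 w)

    spine : ℕ → Fin 2 → Vertex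
    spine 0 c = lRung (c ↑ˡ suc (N + N)) 0F
    spine 1 c = lRung (c ↑ˡ suc (N + N)) 1F
    spine 2 c = inj₁ c
    spine 3 c = link c
    spine 4 c = rRung (c ↑ˡ suc (N + N)) 0F
    spine (suc (suc (suc (suc (suc _))))) c = rRung (c ↑ˡ suc (N + N)) 1F

    spine-position : ∀ k → k < 6 → ∀ c → position (spine k c) ≡ (toℕ c , suc k)
    spine-position 0 _ c = cong (_, 1) (toℕ-↑ˡ c _)
    spine-position 1 _ c = cong (_, 2) (toℕ-↑ˡ c _)
    spine-position 2 _ c = refl
    spine-position 3 _ c = refl
    spine-position 4 _ c = cong (_, 5) (toℕ-↑ˡ c _)
    spine-position 5 _ c = cong (_, 6) (toℕ-↑ˡ c _)
    spine-position (suc (suc (suc (suc (suc (suc _)))))) (s≤s (s≤s (s≤s (s≤s (s≤s (s≤s ())))))) _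

    spine-across : ∀ k → cross (spine k 0F) (spine k 1F) ≡ false
    spine-across 0 = refl
    spine-across 1 = refl
    spine-across 2 = refl
    spine-across 3 = refl
    spine-across 4 = refl
    spine-across (suc (suc (suc (suc (suc _))))) = refl

    spine-along : ∀ k c → cross (spine k c) (spine (suc k) c) ≡ false
    spine-along 0 c = refl
    spine-along 1 c = refl
    spine-along 2 c = refl
    spine-along 3 c = refl
    spine-along 4 c = refl
    spine-along (suc (suc (suc (suc (suc _))))) c = refl

    module Rigid {i} (i∈A : lookup A i ≡ true) (i∈B : lookup B i ≡ true)
                    {g : Vertex → Point} (g-injective : Injective _≡_ _≡_ g)
                    (links : ∀ w w' → Link w w' → GridAdj (g w) (g w')) where

      open Rigidity g g-injective

      edge : ∀ w w' {p q} → cross w w' ≡ false → position w ≡ p → position w' ≡ q → p ∼ q → GridAdj (g w) (g w')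
      edge w w' apart pw pw' adj = links w w' (link-at w w' apart pw pw' adj)

      distinct : ∀ {w w' p q} → position w ≡ p → position w' ≡ q → ¬ p ≡ q → ¬ w ≡ w'
      distinct refl refl p≢q refl = p≢q refl

      a₀₀ a₁₀ a₀₁ a₁₁ : Vertex
      a₀₀ = lRung 0F 0F
      a₁₀ = lRung 1F 0F
      a₀₁ = lRung 0F 1F
      a₁₁ = lRung 1F 1F

      module Framed (u d : Dir) (u⊥d : Perp u d) (g₁₀ : g a₁₀ ≡ g a₀₀ ⊕ vec u) (g₀₁ : g a₀₁ ≡ g a₀₀ ⊕ vec d)
                    (g₁₁ : g a₁₁ ≡ g a₀₀ ⊕ vec u ⊕ vec d) where

        -- The origin is chosen so that each vertex is placed at `at` of its layout position.
        open Frame u d (g a₀₀ ⊕ vec (opp d))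

        g₀₀ : g a₀₀ ≡ at (0 , 1)
        g₀₀ = sym (trans (at-up 0 0) (trans (cong (_⊕ vec d) at-origin) (back-and-forth (g a₀₀) d)))

        spine-placed : ∀ k → k < 6 → ∀ c → g (spine k c) ≡ at (toℕ c , suc k)
        spine-placed = Ladder.ladder (Perp-sym u⊥d) (λ k c → at (toℕ c , suc k)) (λ k c → at-up (toℕ c) (suc k))
          (λ k → at-right 0 (suc k)) (λ k _ c → spine k c) (ℕ.pred ∘ proj₂ ∘ position)
          (λ k p c → cong (ℕ.pred ∘ proj₂) (spine-position k p c))
          (λ k p q c → edge _ _ (spine-along k c) (spine-position k p c) (spine-position (suc k) q c) up)
          (λ k p → edge _ _ (spine-across k) (spine-position k p 0F) (spine-position k p 1F) right)
          (λ { _ 0F → g₀₀ ; _ 1F → trans g₁₀ (trans (cong (_⊕ vec u) g₀₀) (sym (at-right 0 1))) })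
          (λ { _ 0F → trans g₀₁ (trans (cong (_⊕ vec d) g₀₀) (sym (at-up 0 1)))
             ; _ 1F → trans g₁₁ (trans (cong (λ P → P ⊕ vec u ⊕ vec d) g₀₀)
                                 (trans (cong (_⊕ vec d) (sym (at-right 0 1))) (sym (at-up 1 1)))) })

        lRung-placed : ∀ x (p : x < width) r → g (lRung (fromℕ< p) r) ≡ at (x , suc (toℕ r))
        lRung-placed = Ladder.ladder u⊥d (λ x r → at (x , suc (toℕ r))) (λ x r → at-right x (suc (toℕ r)))
          (λ x → at-up x 1) (λ x p r → lRung (fromℕ< p) r) (proj₁ ∘ position) (λ x p r → toℕ-fromℕ< p)
          (λ x p q r → edge _ _ refl (cong (_, suc (toℕ r)) (toℕ-fromℕ< p)) (cong (_, suc (toℕ r)) (toℕ-fromℕ< q)) right)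
          (λ x p → edge _ _ refl (cong (_, 1) (toℕ-fromℕ< p)) (cong (_, 2) (toℕ-fromℕ< p)) up)
          (λ { _ 0F → spine-placed 0 (ℕ.m≤m+n 1 5) 0F ; _ 1F → spine-placed 1 (ℕ.m≤m+n 2 4) 0F })
          (λ { _ 0F → spine-placed 0 (ℕ.m≤m+n 1 5) 1F ; _ 1F → spine-placed 1 (ℕ.m≤m+n 2 4) 1F })

        rRung-placed : ∀ x (p : x < width) r → g (rRung (fromℕ< p) r) ≡ at (x , 5 + toℕ r)
        rRung-placed = Ladder.ladder u⊥d (λ x r → at (x , 5 + toℕ r)) (λ x r → at-right x (5 + toℕ r))
          (λ x → at-up x 5) (λ x p r → rRung (fromℕ< p) r) (proj₁ ∘ position) (λ x p r → toℕ-fromℕ< p)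
          (λ x p q r → edge _ _ refl (cong (_, 5 + toℕ r) (toℕ-fromℕ< p)) (cong (_, 5 + toℕ r) (toℕ-fromℕ< q)) right)
          (λ x p → edge _ _ refl (cong (_, 5) (toℕ-fromℕ< p)) (cong (_, 6) (toℕ-fromℕ< p)) up)
          (λ { _ 0F → spine-placed 4 (ℕ.m≤m+n 5 1) 0F ; _ 1F → spine-placed 5 ℕ.≤-refl 0F })
          (λ { _ 0F → spine-placed 4 (ℕ.m≤m+n 5 1) 1F ; _ 1F → spine-placed 5 ℕ.≤-refl 1F })

        x : ℕ
        x = bumpColumn i
        here< : x < width
        here< = bumpColumn<width i
        right< : suc x < width
        right< = bumpColumn+1<width i
        left< : ℕ.pred x < width
        left< = ℕ.<-trans (ℕ.n<1+n _) here<

        lBump-placed : g (lBump i) ≡ at (x , 3)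
        lBump-placed = trans
          (pendant u⊥d {x = lRung (fromℕ< here<) 1F} {lRung (fromℕ< left<) 1F} {lRung (fromℕ< right<) 1F}
                       {lRung (fromℕ< here<) 0F} {lBump i} {at (x , 2)}
            (lRung-placed x here< 1F) (trans (lRung-placed _ left< 1F) (at-left (ℕ.pred x) 2))
            (trans (lRung-placed _ right< 1F) (at-right x 2)) (trans (lRung-placed x here< 0F) (at-down x 1))
            (edge _ _ refl (cong (_, 2) (toℕ-fromℕ< here<)) (lBump-at i∈A) up)
            (distinct (lBump-at i∈A) (cong (_, 2) (toℕ-fromℕ< left<)) λ ())
            (distinct (lBump-at i∈A) (cong (_, 2) (toℕ-fromℕ< right<)) λ ())
            (distinct (lBump-at i∈A) (cong (_, 1) (toℕ-fromℕ< here<)) λ ()))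
          (sym (at-up x 2))

        rBump-placed : g (rBump i) ≡ at (x , 4)
        rBump-placed = trans
          (pendant (Perp-opp u⊥d) {x = rRung (fromℕ< here<) 0F} {rRung (fromℕ< left<) 0F} {rRung (fromℕ< right<) 0F}
                       {rRung (fromℕ< here<) 1F} {rBump i} {at (x , 5)}
            (rRung-placed x here< 0F) (trans (rRung-placed _ left< 0F) (at-left (ℕ.pred x) 5))
            (trans (rRung-placed _ right< 0F) (at-right x 5))
            (trans (rRung-placed x here< 1F) (trans (at-up x 5) (cong (λ e → at (x , 5) ⊕ vec e) (sym (opp-involutive d)))))
            (edge _ _ refl (cong (_, 5) (toℕ-fromℕ< here<)) (rBump-at i∈B) down)
            (distinct (rBump-at i∈B) (cong (_, 5) (toℕ-fromℕ< left<)) λ ())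
            (distinct (rBump-at i∈B) (cong (_, 5) (toℕ-fromℕ< right<)) λ ())
            (distinct (rBump-at i∈B) (cong (_, 6) (toℕ-fromℕ< here<)) λ ()))
          (sym (at-down x 4))

        bumps-adjacent : GridAdj (g (lBump i)) (g (rBump i))
        bumps-adjacent = subst₂ GridAdj (sym lBump-placed) (sym (trans rBump-placed (at-up x 3)))
                                (step⇒GridAdj (at (x , 3)) d)

      bumps-adjacent : GridAdj (g (lBump i)) (g (rBump i))
      bumps-adjacent = framed (square-frame (edge a₀₀ a₁₀ refl refl refl right) (edge a₀₀ a₀₁ refl refl refl up)
                                            (edge a₁₀ a₁₁ refl refl refl up) (edge a₀₁ a₁₁ refl refl refl right)
                                            (λ ()) (λ ()))
        where
        framed : (Σ Dir λ u → Σ Dir λ d → Perp u d × g a₁₀ ≡ g a₀₀ ⊕ vec u × g a₀₁ ≡ g a₀₀ ⊕ vec d ×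
                                            g a₁₁ ≡ g a₀₀ ⊕ vec u ⊕ vec d) → GridAdj (g (lBump i)) (g (rBump i))
        framed (u , d , u⊥d , g₁₀ , g₀₁ , g₁₁) = Framed.bumps-adjacent u d u⊥d g₁₀ g₀₁ g₁₁

    not-gridClass : ∀ {i} → i ∈ A ∩ B → ¬ GridClass (GlueV L R) (GlueE L R)
    not-gridClass {i} i∈A∩B = collapse ∘ grid-embedding
      where
      i∈A : lookup A i ≡ true
      i∈A = []=⇒lookup (proj₁ (x∈p∩q⁻ A B i∈A∩B))
      i∈B : lookup B i ≡ true
      i∈B = []=⇒lookup (proj₂ (x∈p∩q⁻ A B i∈A∩B))
      collapse : (Σ[ g ∈ (Vertex → Point) ] (Injective _≡_ _≡_ g ×
        (∀ w w' → Link w w' → GridAdj (g w) (g w')) × (∀ w w' → cross w w' ≡ true → ¬ GridAdj (g w) (g w')))) → ⊥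
      collapse (g , g-injective , links , no-cross) =
        no-cross (lBump i) (rBump i) refl (Rigid.bumps-adjacent i∈A i∈B g-injective links)

    gridClass⇔disjoint : GridClass (GlueV L R) (GlueE L R) ⇔ Empty (A ∩ B)
    gridClass⇔disjoint = mk⇔ (λ grid (_ , i∈A∩B) → not-gridClass i∈A∩B grid)
      (λ disjoint → gridClass (connected (inj₁ 0F) reach) position-injective (no-cross-adjacency disjoint))

  vertex-count : ℕ
  vertex-count = 2 + ((width * 2 + N) + (2 + (width * 2 + N)))

vertex-count≤26N : ∀ M → Construction.vertex-count (suc M) ^ 1 ≤ 26 * suc M
vertex-count≤26N M = subst (Construction.vertex-count (suc M) ^ 1 ≤_) (count+16M M) (ℕ.m≤m+n _ (16 * M))
  where
  -- vertex-count unfolded, as the solver treats defined names as atoms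
  count+16M : ∀ M → (2 + (((3 + ((1 + M) + (1 + M))) * 2 + (1 + M)) + (2 + ((3 + ((1 + M) + (1 + M))) * 2 + (1 + M))))) * 1
                      + 16 * M ≡ 26 * (1 + M)
  count+16M = ℕ-Solver.solve-∀

corollary5p6 : DisjointnessExpressing GridClass 6 1
corollary5p6 = 26 , s≤s z≤n , λ
  { zero    ()
  ; (suc M) _ → let open Construction (suc M) in
      2 , leftGraph , rightGraph , λ A B → let open Layout A B in
        (connected (inj₁ 0F) reach , vertex-count , GlueV-size L R , vertex-count≤26N M) ,
        ((λ A' B' → N[S]-iso (placeL-stable A A') (placeR-stable B B')) , N[S]-has-six) ,
        gridClass⇔disjoint
  }
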